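{- Let $p$ be a prime number. If $2p$ lies in the image of $\phi$, then $2^k p$ lies in the image of $\phi$ for every integer $k \ge 1$.
   Context: $\mathbb{N}^*$ denotes the set of positive integers. $\phi$ is Euler's totient function: for $n \in \mathbb{N}^*$, $\phi(n)$ is the number of integers $x$ with $1 \le x \le n$ and $\gcd(x,n) = 1$. The image of $\phi$ is $\{\phi(n) : n \in \mathbb{N}^*\}$. -}

module Defs where

open import Data.Nat using (ℕ; zero; suc; _≟_)
open import Data.Nat.GCD using (gcd)
open import Data.List using (List; length; filter)
open import Data.List.Base using (applyUpTo)
open import Data.Product using (∃-syntax; _×_)
open import Data.Nat using (_≤_)
open import Relation.Binary.PropositionalEquality using (_≡_)

φ : ℕ → ℕ
φ n = length (filter (λ x → gcd x n ≟ 1) (applyUpTo suc n))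

InImageφ : ℕ → Set
InImageφ m = ∃[ n ] (1 ≤ n × φ n ≡ m)

-- φ(2m) = 2φ(m) for even m, because x ↦ [x coprime to 2m] = [x coprime to m] has period m;
-- φ(2m) = φ(m) for odd m, because of x and m + x exactly one is odd. Hence every value of φ
-- has an even preimage n, and then φ(2ʲ n) = 2ʲ φ(n).
module Submission where

open import Defs
open import Data.Bool.Base using (if_then_else_)
open import Data.List.Base using (applyUpTo; filter; length)
open import Data.Nat using (ℕ; zero; suc; _+_; _*_; _^_; _≤_; _≟_; s≤s; z≤n)
open import Data.Nat.GCD using (gcd)
open import Data.Nat.Coprimality using (Coprime; coprime?; coprime-+; coprime-divisor)
open import Data.Nat.Divisibility using (_∣_; ∣-trans; ∣m∣n⇒∣m+n; m∣m*n; n∣m*n)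
open import Data.Nat.Primality using (Prime)
open import Data.Nat.Properties
open import Algebra.Properties.CommutativeSemigroup +-commutativeSemigroup using (interchange)
open import Data.Product using (∃-syntax; _×_; _,_; proj₂)
open import Data.Sum using (_⊎_; inj₁; inj₂)
open import Function using (_∘_; _⇔_; mk⇔; Equivalence)
open import Relation.Nullary using (Dec; does; yes; no; _×-dec_)
open import Relation.Unary using (Decidable)
open import Relation.Binary.PropositionalEquality using (_≡_; refl; sym; trans; cong; cong₂; module ≡-Reasoning)

open Equivalence using (to; from)

sumUpTo : (ℕ → ℕ) → ℕ → ℕ
sumUpTo g zero    = 0
sumUpTo g (suc n) = g 0 + sumUpTo (g ∘ suc) n

sumUpTo-cong : ∀ {g h} → (∀ i → g i ≡ h i) → ∀ n → sumUpTo g n ≡ sumUpTo h n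
sumUpTo-cong g≗h zero    = refl
sumUpTo-cong g≗h (suc n) = cong₂ _+_ (g≗h 0) (sumUpTo-cong (g≗h ∘ suc) n)

sumUpTo-+ : ∀ g m n → sumUpTo g (m + n) ≡ sumUpTo g m + sumUpTo (λ i → g (m + i)) n
sumUpTo-+ g zero    n = refl
sumUpTo-+ g (suc m) n =
  trans (cong (g 0 +_) (sumUpTo-+ (g ∘ suc) m n)) (sym (+-assoc (g 0) _ _))

sumUpTo-distrib : ∀ g h n → sumUpTo (λ i → g i + h i) n ≡ sumUpTo g n + sumUpTo h n
sumUpTo-distrib g h zero    = refl
sumUpTo-distrib g h (suc n) =
  trans (cong (g 0 + h 0 +_) (sumUpTo-distrib (g ∘ suc) (h ∘ suc) n))
        (interchange (g 0) (h 0) (sumUpTo (g ∘ suc) n) (sumUpTo (h ∘ suc) n))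

sumUpTo-periodic : ∀ {g m} → (∀ i → g (m + i) ≡ g i) →
                   ∀ d → sumUpTo g (d * m) ≡ d * sumUpTo g m
sumUpTo-periodic         g-periodic zero    = refl
sumUpTo-periodic {g} {m} g-periodic (suc d) = begin
  sumUpTo g (m + d * m)                            ≡⟨ sumUpTo-+ g m (d * m) ⟩
  sumUpTo g m + sumUpTo (λ i → g (m + i)) (d * m)  ≡⟨ cong (sumUpTo g m +_) (sumUpTo-cong g-periodic (d * m)) ⟩
  sumUpTo g m + sumUpTo g (d * m)                  ≡⟨ cong (sumUpTo g m +_) (sumUpTo-periodic g-periodic d) ⟩
  sumUpTo g m + d * sumUpTo g m                    ∎
  where open ≡-Reasoning

sumUpTo-2* : ∀ g m → sumUpTo g (2 * m) ≡ sumUpTo (λ i → g i + g (m + i)) m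
sumUpTo-2* g m = begin
  sumUpTo g (m + 1 * m)                           ≡⟨ sumUpTo-+ g m (1 * m) ⟩
  sumUpTo g m + sumUpTo (λ i → g (m + i)) (1 * m) ≡⟨ cong (λ k → sumUpTo g m + sumUpTo (λ i → g (m + i)) k) (*-identityˡ m) ⟩
  sumUpTo g m + sumUpTo (λ i → g (m + i)) m       ≡⟨ sumUpTo-distrib g (λ i → g (m + i)) m ⟨
  sumUpTo (λ i → g i + g (m + i)) m               ∎
  where open ≡-Reasoning

𝟙 : ∀ {a} {A : Set a} → Dec A → ℕ
𝟙 a? = if does a? then 1 else 0

𝟙-cong : ∀ {a b} {A : Set a} {B : Set b} → A ⇔ B → (a? : Dec A) (b? : Dec B) → 𝟙 a? ≡ 𝟙 b?
𝟙-cong A⇔B (yes _) (yes _) = refl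
𝟙-cong A⇔B (no _)  (no _)  = refl
𝟙-cong A⇔B (yes a) (no ¬b) with () ← ¬b (to A⇔B a)
𝟙-cong A⇔B (no ¬a) (yes b) with () ← ¬a (from A⇔B b)

𝟙-×-dec : ∀ {a b} {A : Set a} {B : Set b} (a? : Dec A) (b? : Dec B) → 𝟙 (a? ×-dec b?) ≡ 𝟙 a? * 𝟙 b?
𝟙-×-dec (yes _) (yes _) = refl
𝟙-×-dec (yes _) (no _)  = refl
𝟙-×-dec (no _)  _       = refl

length-filter-applyUpTo : ∀ {P : ℕ → Set} (P? : Decidable P) f n →
                          length (filter P? (applyUpTo f n)) ≡ sumUpTo (λ i → 𝟙 (P? (f i))) n
length-filter-applyUpTo P? f zero = refl
length-filter-applyUpTo P? f (suc n) with P? (f 0)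
... | yes _ = cong suc (length-filter-applyUpTo P? (f ∘ suc) n)
... | no _  = length-filter-applyUpTo P? (f ∘ suc) n

coprime-∣ˡ : ∀ {d x m} → d ∣ x → Coprime x m → Coprime d m
coprime-∣ˡ d∣x coprime (i∣d , i∣m) = coprime (∣-trans i∣d d∣x , i∣m)

coprime-∣ʳ : ∀ {x d m} → d ∣ m → Coprime x m → Coprime x d
coprime-∣ʳ d∣m coprime (i∣x , i∣d) = coprime (i∣x , ∣-trans i∣d d∣m)

coprime-*ʳ : ∀ {x a b} → Coprime x a → Coprime x b → Coprime x (a * b)
coprime-*ʳ ca cb (i∣x , i∣ab) = cb (i∣x , coprime-divisor (coprime-∣ˡ i∣x ca) i∣ab)

coprime-*ʳ⇔ : ∀ {x a b} → Coprime x (a * b) ⇔ (Coprime x a × Coprime x b)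
coprime-*ʳ⇔ {x} {a} {b} = mk⇔ split (λ (ca , cb) → coprime-*ʳ ca cb)
  where
  split : Coprime x (a * b) → Coprime x a × Coprime x b
  split c = coprime-∣ʳ (m∣m*n b) c , coprime-∣ʳ (n∣m*n a) c

coprime-+⇔ : ∀ {m x} → Coprime (m + x) m ⇔ Coprime x m
coprime-+⇔ {m} {x} = mk⇔ drop coprime-+
  where
  drop : Coprime (m + x) m → Coprime x m
  drop coprime (i∣x , i∣m) = coprime (∣m∣n⇒∣m+n i∣m i∣x , i∣m)

coprimeTo : ℕ → ℕ → ℕ
coprimeTo m x = 𝟙 (coprime? x m)

φ≡sumUpTo-coprimeTo : ∀ n → φ n ≡ sumUpTo (coprimeTo n ∘ suc) n
φ≡sumUpTo-coprimeTo n = length-filter-applyUpTo (λ x → gcd x n ≟ 1) suc n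

coprimeTo-* : ∀ a b x → coprimeTo (a * b) x ≡ coprimeTo a x * coprimeTo b x
coprimeTo-* a b x =
  trans (𝟙-cong coprime-*ʳ⇔ (coprime? x (a * b)) (coprime? x a ×-dec coprime? x b))
        (𝟙-×-dec (coprime? x a) (coprime? x b))

coprimeTo-+ : ∀ m x → coprimeTo m (m + x) ≡ coprimeTo m x
coprimeTo-+ m x = 𝟙-cong coprime-+⇔ (coprime? (m + x) m) (coprime? x m)

coprimeTo-*-∣ : ∀ {d m} → d ∣ m → ∀ x → coprimeTo (d * m) x ≡ coprimeTo m x
coprimeTo-*-∣ {d} {m} d∣m x =
  𝟙-cong (mk⇔ (proj₂ ∘ to (coprime-*ʳ⇔ {x} {d})) widen) (coprime? x (d * m)) (coprime? x m)
  where
  widen : Coprime x m → Coprime x (d * m)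
  widen c = coprime-*ʳ (coprime-∣ʳ d∣m c) c

φ-*-∣ : ∀ {d m} → d ∣ m → φ (d * m) ≡ d * φ m
φ-*-∣ {d} {m} d∣m = begin
  φ (d * m)                                 ≡⟨ φ≡sumUpTo-coprimeTo (d * m) ⟩
  sumUpTo (coprimeTo (d * m) ∘ suc) (d * m) ≡⟨ sumUpTo-cong (coprimeTo-*-∣ d∣m ∘ suc) (d * m) ⟩
  sumUpTo (coprimeTo m ∘ suc) (d * m)       ≡⟨ sumUpTo-periodic shift d ⟩
  d * sumUpTo (coprimeTo m ∘ suc) m         ≡⟨ cong (d *_) (φ≡sumUpTo-coprimeTo m) ⟨
  d * φ m                                   ∎
  where
  open ≡-Reasoning
  shift : ∀ i → coprimeTo m (suc (m + i)) ≡ coprimeTo m (suc i)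
  shift i = trans (cong (coprimeTo m) (sym (+-suc m i))) (coprimeTo-+ m (suc i))

coprimeTo-2-alternates : ∀ x → coprimeTo 2 x + coprimeTo 2 (suc x) ≡ 1
coprimeTo-2-alternates zero    = refl
coprimeTo-2-alternates (suc x) =
  trans (cong (coprimeTo 2 (suc x) +_) (coprimeTo-+ 2 x))
        (trans (+-comm (coprimeTo 2 (suc x)) _) (coprimeTo-2-alternates x))

coprimeTo-2-odd-shift : ∀ t x → coprimeTo 2 x + coprimeTo 2 (suc (2 * t) + x) ≡ 1
coprimeTo-2-odd-shift zero    x = coprimeTo-2-alternates x
coprimeTo-2-odd-shift (suc t) x = begin
  coprimeTo 2 x + coprimeTo 2 (suc (2 * suc t) + x)   ≡⟨ cong (λ k → coprimeTo 2 x + coprimeTo 2 (suc k + x)) (*-suc 2 t) ⟩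
  coprimeTo 2 x + coprimeTo 2 (2 + (suc (2 * t) + x)) ≡⟨ cong (coprimeTo 2 x +_) (coprimeTo-+ 2 (suc (2 * t) + x)) ⟩
  coprimeTo 2 x + coprimeTo 2 (suc (2 * t) + x)       ≡⟨ coprimeTo-2-odd-shift t x ⟩
  1                                                   ∎
  where open ≡-Reasoning

φ-2*-odd : ∀ t → φ (2 * suc (2 * t)) ≡ φ (suc (2 * t))
φ-2*-odd t = begin
  φ (2 * m)                                   ≡⟨ φ≡sumUpTo-coprimeTo (2 * m) ⟩
  sumUpTo (coprimeTo (2 * m) ∘ suc) (2 * m)   ≡⟨ sumUpTo-2* (coprimeTo (2 * m) ∘ suc) m ⟩
  sumUpTo (λ i → coprimeTo (2 * m) (suc i) + coprimeTo (2 * m) (suc (m + i))) m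
                                              ≡⟨ sumUpTo-cong pair-suc m ⟩
  sumUpTo (coprimeTo m ∘ suc) m               ≡⟨ φ≡sumUpTo-coprimeTo m ⟨
  φ m                                         ∎
  where
  open ≡-Reasoning
  m : ℕ
  m = suc (2 * t)
  pair : ∀ x → coprimeTo (2 * m) x + coprimeTo (2 * m) (m + x) ≡ coprimeTo m x
  pair x = begin
    coprimeTo (2 * m) x + coprimeTo (2 * m) (m + x)
      ≡⟨ cong₂ _+_ (coprimeTo-* 2 m x) (coprimeTo-* 2 m (m + x)) ⟩
    coprimeTo 2 x * coprimeTo m x + coprimeTo 2 (m + x) * coprimeTo m (m + x)
      ≡⟨ cong (λ c → coprimeTo 2 x * coprimeTo m x + coprimeTo 2 (m + x) * c) (coprimeTo-+ m x) ⟩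
    coprimeTo 2 x * coprimeTo m x + coprimeTo 2 (m + x) * coprimeTo m x
      ≡⟨ *-distribʳ-+ (coprimeTo m x) (coprimeTo 2 x) _ ⟨
    (coprimeTo 2 x + coprimeTo 2 (m + x)) * coprimeTo m x
      ≡⟨ cong (_* coprimeTo m x) (coprimeTo-2-odd-shift t x) ⟩
    1 * coprimeTo m x
      ≡⟨ *-identityˡ (coprimeTo m x) ⟩
    coprimeTo m x ∎
  pair-suc : ∀ i → coprimeTo (2 * m) (suc i) + coprimeTo (2 * m) (suc (m + i)) ≡ coprimeTo m (suc i)
  pair-suc i = trans (cong (λ y → coprimeTo (2 * m) (suc i) + coprimeTo (2 * m) y) (sym (+-suc m i)))
                     (pair (suc i))

even-or-odd : ∀ n → (∃[ t ] n ≡ 2 * t) ⊎ (∃[ t ] n ≡ suc (2 * t))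
even-or-odd zero = inj₁ (0 , refl)
even-or-odd (suc n) with even-or-odd n
... | inj₁ (t , n≡2t)   = inj₂ (t , cong suc n≡2t)
... | inj₂ (t , n≡2t+1) = inj₁ (suc t , trans (cong suc n≡2t+1) (sym (*-suc 2 t)))

InImageφ⇒even-preimage : ∀ {v} → InImageφ v → ∃[ n ] (1 ≤ n × 2 ∣ n × φ n ≡ v)
InImageφ⇒even-preimage (n , 1≤n , φn≡v) with even-or-odd n
... | inj₁ (t , refl) = 2 * t , 1≤n , m∣m*n t , φn≡v
... | inj₂ (t , refl) = 2 * suc (2 * t) , s≤s z≤n , m∣m*n (suc (2 * t)) , trans (φ-2*-odd t) φn≡v

φ-2^*-even : ∀ j {n} → 2 ∣ n → φ (2 ^ j * n) ≡ 2 ^ j * φ n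
φ-2^*-even zero    {n} 2∣n = trans (cong φ (*-identityˡ n)) (sym (*-identityˡ (φ n)))
φ-2^*-even (suc j) {n} 2∣n = begin
  φ (2 * 2 ^ j * n)       ≡⟨ cong φ (*-assoc 2 (2 ^ j) n) ⟩
  φ (2 * (2 ^ j * n))     ≡⟨ φ-*-∣ (∣-trans 2∣n (n∣m*n (2 ^ j))) ⟩
  2 * φ (2 ^ j * n)       ≡⟨ cong (2 *_) (φ-2^*-even j 2∣n) ⟩
  2 * (2 ^ j * φ n)       ≡⟨ *-assoc 2 (2 ^ j) (φ n) ⟨
  2 * 2 ^ j * φ n         ∎
  where open ≡-Reasoning

corollary2 : (p : ℕ) → Prime p → InImageφ (2 * p) →
    (k : ℕ) → 1 ≤ k → InImageφ (2 ^ k * p)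
corollary2 p _ 2p∈imφ (suc j) _ with InImageφ⇒even-preimage 2p∈imφ
... | n , 1≤n , 2∣n , φn≡2p = 2 ^ j * n , *-mono-≤ (m^n>0 2 j) 1≤n , (begin
  φ (2 ^ j * n)    ≡⟨ φ-2^*-even j 2∣n ⟩
  2 ^ j * φ n      ≡⟨ cong (2 ^ j *_) φn≡2p ⟩
  2 ^ j * (2 * p)  ≡⟨ *-assoc (2 ^ j) 2 p ⟨
  2 ^ j * 2 * p    ≡⟨ cong (_* p) (*-comm (2 ^ j) 2) ⟩
  2 * 2 ^ j * p    ∎)
  where open ≡-Reasoning
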